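{- Let $U_1,\dots,U_m$ and $V_1,\dots,V_m$ be nonzero finite-dimensional vector spaces over a field $K$, $\widetilde U=U_1\otimes\cdots\otimes U_m$, $\widetilde V=V_1\otimes\cdots\otimes V_m$. Let $\tau,\tau'\in S_m$ with $\dim V_{\tau(i)}=\dim V_{\tau'(i)}=\dim U_i$ for all $i$, let $\varphi_i:U_i\to V_{\tau(i)}$ and $\varphi_i':U_i\to V_{\tau'(i)}$ be linear isomorphisms, and let $\varphi,\varphi':\widetilde U\to\widetilde V$ be the decomposable isomorphisms determined by $(\tau;\varphi_1,\dots,\varphi_m)$ and $(\tau';\varphi'_1,\dots,\varphi'_m)$ respectively. Suppose $\varphi=\varphi'$. Then: 1) $\tau'=\tau\sigma$ for a permutation $\sigma$ of $\{1,\dots,m\}$ with $\sigma(i)=i$ for every $i$ with $\dim U_i>1$; in particular $\tau'=\tau$ if at most one of the spaces $U_i$ is one-dimensional. 2) If $\tau=\tau'$, then there exist $\lambda_1,\dots,\lambda_m\in K^\ast$ with $\varphi_i'=\lambda_i\varphi_i$ for all $i$, and $\lambda_1\cdots\lambda_m=1$.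
   Context: The decomposable isomorphism determined by data $(\tau;\varphi_1,\dots,\varphi_m)$, where $\tau$ is a permutation of $\{1,\dots,m\}$ and $\varphi_i:U_i\to V_{\tau(i)}$ are isomorphisms, is the linear isomorphism $\varphi$ with $\varphi(u_1\otimes\cdots\otimes u_m)=\varphi_{\tau^{ -1}(1)}(u_{\tau^{ -1}(1)})\otimes\cdots\otimes\varphi_{\tau^{ -1}(m)}(u_{\tau^{ -1}(m)})$. -}

module Defs where

open import Level using (Level; _⊔_) renaming (suc to lsuc)
open import Data.Nat using (ℕ; _<_; _≤_)
open ℕ
open import Data.Fin using (Fin; zero; suc; _≟_)
open import Relation.Nullary using (yes; no)
open import Data.Fin.Permutation using (Permutation′; _⟨$⟩ʳ_)
open import Data.Product using (Σ; _×_; _,_; ∃)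
open import Relation.Nullary using (¬_)
open import Algebra.Bundles using (CommutativeRing)

record Field (c ℓ : Level) : Set (lsuc (c ⊔ ℓ)) where
  field
    commutativeRing : CommutativeRing c ℓ
  open CommutativeRing commutativeRing public
  field
    0≉1 : ¬ (0# ≈ 1#)
    inverse : ∀ x → ¬ (x ≈ 0#) → Σ Carrier (λ y → x * y ≈ 1#)

module FieldOps {c ℓ : Level} (K : Field c ℓ) where
  open Field K hiding (zero) public

  Σ[_] : (n : ℕ) → (Fin n → Carrier) → Carrier
  Σ[ zero ] f = 0#
  Σ[ suc n ] f = f zero + Σ[ n ] (λ i → f (suc i))

  Π[_] : (n : ℕ) → (Fin n → Carrier) → Carrier
  Π[ zero ] f = 1#
  Π[ suc n ] f = f zero * Π[ n ] (λ i → f (suc i))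

  -- A linear map K^c → K^r, as an r × c matrix (w.r.t. the standard bases)
  Mat : ℕ → ℕ → Set c
  Mat r c′ = Fin r → Fin c′ → Carrier

  _·_ : ∀ {r k c′} → Mat r k → Mat k c′ → Mat r c′
  _·_ {k = k} A B i j = Σ[ k ] (λ l → A i l * B l j)

  I : ∀ {n} → Mat n n
  I i j with i ≟ j
  ... | yes _ = 1#
  ... | no _ = 0#

  _≈M_ : ∀ {r c′} → Mat r c′ → Mat r c′ → Set ℓ
  A ≈M B = ∀ i j → A i j ≈ B i j

  IsIso : ∀ {r c′} → Mat r c′ → Set (c ⊔ ℓ)
  IsIso {r} {c′} A = Σ (Mat c′ r) (λ B → ((A · B) ≈M I) × ((B · A) ≈M I))

  -- The tensor product U₁ ⊗ ⋯ ⊗ U_m with U_i = K^(d i), in coordinates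
  -- w.r.t. the basis of pure tensors of standard basis vectors, indexed
  -- by multi-indices.
  MultiIndex : (m : ℕ) → (Fin m → ℕ) → Set
  MultiIndex m d = (i : Fin m) → Fin (d i)

  -- Matrix of the decomposable isomorphism determined by (τ; φ₁,…,φ_m),
  -- φ_i : U_i → V_{τ(i)}.  Its column at the basis tensor e_I
  -- (I a multi-index for Ũ) is the pure tensor
  -- φ_{τ⁻¹(1)}(e_{I(τ⁻¹1)}) ⊗ ⋯ ⊗ φ_{τ⁻¹(m)}(e_{I(τ⁻¹m)}),
  -- whose J-th coordinate is ∏_j φ_{τ⁻¹ j}[J j , I (τ⁻¹ j)]
  --                        = ∏_i φ_i[J (τ i) , I i]   (reindexing j = τ i).
  decomposable : (m : ℕ) (d e : Fin m → ℕ) (τ : Permutation′ m)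
    → ((i : Fin m) → Mat (e (τ ⟨$⟩ʳ i)) (d i))
    → MultiIndex m e → MultiIndex m d → Carrier
  decomposable m d e τ φ J I′ = Π[ m ] (λ i → φ i (J (τ ⟨$⟩ʳ i)) (I′ i))

-- In coordinates the decomposable map of (τ; φ₁,…,φ_m) is the Kronecker product of the φ_i with
-- its row multi-index permuted by τ. Fix every index except the column index of factor i and the
-- row index at position τ(i): the resulting slice is a nonzero multiple of φ_i. If τ′(i) ≠ τ(i),
-- the same slice of the τ′-map has rank at most one, because its row index now feeds a different
-- factor; an invertible φ_i with dim U_i ≥ 2 has rank at least two, so τ′ = τσ with σ = τ⁻¹τ′
-- fixing every i with dim U_i > 1. For τ′ = τ, multiplying the equation factorwise by φ_i⁻¹ gives
-- ⨂ (φ_i⁻¹ φ′_i) = id, and slicing at a diagonal entry shows each φ_i⁻¹ φ′_i is a scalar λ_i,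
-- with ∏ λ_i = 1 read off from the diagonal.

module Submission where

open import Defs
open import Data.Nat using (ℕ; zero; suc; _<_; _≤_; s≤s)
open import Data.Nat.Properties using (≤∧≢⇒<)
open import Data.Fin using (Fin; zero; suc; _≟_; punchIn; fromℕ<)
open import Data.Fin.Properties using (suc-injective; punchInᵢ≢i)
open import Data.Fin.Permutation using (Permutation′; _⟨$⟩ʳ_; _⟨$⟩ˡ_; inverseˡ; inverseʳ; flip; _∘ₚ_)
open import Data.Vec.Functional using (removeAt)
open import Data.Product using (Σ; _×_; _,_; proj₁; proj₂)
open import Data.Empty using (⊥-elim)
open import Function using (_∘_)
open import Function.Bundles using (Injection)
open import Function.Properties.Inverse using (↔⇒↣)
open import Relation.Nullary using (¬_; yes; no)
open import Relation.Binary.PropositionalEquality as ≡ using (_≡_; _≢_; cong; cong₂; subst)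
import Algebra.Properties.CommutativeSemigroup as CommutativeSemigroupProperties
import Relation.Binary.Reasoning.Setoid as SetoidReasoning

¬¬-pull : ∀ {p} n {P : Fin n → Set p} → (∀ k → ¬ ¬ P k) → ¬ ¬ (∀ k → P k)
¬¬-pull zero    ¬¬P ¬∀P = ¬∀P (λ ())
¬¬-pull (suc n) ¬¬P ¬∀P =
  ¬¬P zero λ P₀ → ¬¬-pull n (¬¬P ∘ suc) λ P₊ → ¬∀P λ { zero → P₀ ; (suc k) → P₊ k }

update : ∀ {n} {F : Fin n → Set} → ((k : Fin n) → F k) → (i : Fin n) → F i → (k : Fin n) → F k
update x zero    v zero    = v
update x zero    v (suc k) = x (suc k)
update x (suc i) v zero    = x zero
update x (suc i) v (suc k) = update (x ∘ suc) i v k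

update-updates : ∀ {n} {F : Fin n → Set} (x : (k : Fin n) → F k) i v → update x i v i ≡ v
update-updates x zero    v = ≡.refl
update-updates x (suc i) v = update-updates (x ∘ suc) i v

update-minimal : ∀ {n} {F : Fin n → Set} (x : (k : Fin n) → F k) {i k} v → k ≢ i → update x i v k ≡ x k
update-minimal x {zero}  {zero}  v k≢i = ⊥-elim (k≢i ≡.refl)
update-minimal x {zero}  {suc k} v k≢i = ≡.refl
update-minimal x {suc i} {zero}  v k≢i = ≡.refl
update-minimal x {suc i} {suc k} v k≢i = update-minimal (x ∘ suc) v (k≢i ∘ cong suc)

⟨$⟩ʳ-injective : ∀ {m} (σ : Permutation′ m) {i j} → σ ⟨$⟩ʳ i ≡ σ ⟨$⟩ʳ j → i ≡ j
⟨$⟩ʳ-injective σ = Injection.injective (↔⇒↣ σ)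

reindex : ∀ {m} {F : Fin m → Set} (τ : Permutation′ m) → ((k : Fin m) → F (τ ⟨$⟩ʳ k)) → (j : Fin m) → F j
reindex {F = F} τ x j = subst F (inverseʳ τ) (x (τ ⟨$⟩ˡ j))

reindex-⟨$⟩ʳ : ∀ {m} {F : Fin m → Set} (τ : Permutation′ m) (x : (k : Fin m) → F (τ ⟨$⟩ʳ k)) k
  → reindex {F = F} τ x (τ ⟨$⟩ʳ k) ≡ x k
reindex-⟨$⟩ʳ {F = F} τ x k = subst-at (inverseˡ τ) (inverseʳ τ)
  where
  subst-at : ∀ {k′} → k′ ≡ k → (p : τ ⟨$⟩ʳ k′ ≡ τ ⟨$⟩ʳ k) → subst F p (x k′) ≡ x k
  subst-at ≡.refl ≡.refl = ≡.refl

agreement⇒factorisation : ∀ {m p} (τ τ′ : Permutation′ m) (P : Fin m → Set p)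
  → (∀ i → P i → τ′ ⟨$⟩ʳ i ≡ τ ⟨$⟩ʳ i)
  → Σ (Permutation′ m) λ σ → (∀ i → τ′ ⟨$⟩ʳ i ≡ τ ⟨$⟩ʳ (σ ⟨$⟩ʳ i)) × (∀ i → P i → σ ⟨$⟩ʳ i ≡ i)
agreement⇒factorisation τ τ′ P agree =
  τ′ ∘ₚ flip τ , (λ _ → ≡.sym (inverseʳ τ)) , λ i Pi → ≡.trans (cong (τ ⟨$⟩ˡ_) (agree i Pi)) (inverseˡ τ)

fixes-all-but-one⇒fixes-all : ∀ {m p} (σ : Permutation′ m) (P : Fin m → Set p)
  → (∀ i j → P i → P j → i ≡ j) → (∀ i → ¬ P i → σ ⟨$⟩ʳ i ≡ i) → ∀ i → σ ⟨$⟩ʳ i ≡ i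
fixes-all-but-one⇒fixes-all σ P unique fixes i with σ ⟨$⟩ʳ i ≟ i
... | yes σi≡i = σi≡i
... | no σi≢i = ⊥-elim (¬¬Pi λ Pi → ¬¬Pσi λ Pσi → σi≢i (≡.sym (unique i (σ ⟨$⟩ʳ i) Pi Pσi)))
  where
  ¬¬Pi : ¬ ¬ P i
  ¬¬Pi ¬Pi = σi≢i (fixes i ¬Pi)
  ¬¬Pσi : ¬ ¬ P (σ ⟨$⟩ʳ i)
  ¬¬Pσi ¬Pσi = σi≢i (⟨$⟩ʳ-injective σ (fixes (σ ⟨$⟩ʳ i) ¬Pσi))

module _ {c ℓ} (K : Field c ℓ) where
  open FieldOps K
  open CommutativeSemigroupProperties *-commutativeSemigroup using (x∙yz≈y∙xz; xy∙z≈xz∙y; interchange)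
  open CommutativeSemigroupProperties +-commutativeSemigroup using () renaming (interchange to +-interchange)
  open SetoidReasoning setoid

  Σ-cong : ∀ n {f g : Fin n → Carrier} → (∀ k → f k ≈ g k) → Σ[ n ] f ≈ Σ[ n ] g
  Σ-cong zero    _   = refl
  Σ-cong (suc n) f≈g = +-cong (f≈g zero) (Σ-cong n (f≈g ∘ suc))

  Σ-zero : ∀ n {f : Fin n → Carrier} → (∀ k → f k ≈ 0#) → Σ[ n ] f ≈ 0#
  Σ-zero zero    _   = refl
  Σ-zero (suc n) f≈0 = trans (+-cong (f≈0 zero) (Σ-zero n (f≈0 ∘ suc))) (+-identityˡ 0#)

  Σ-+ : ∀ n (f g : Fin n → Carrier) → Σ[ n ] f + Σ[ n ] g ≈ Σ[ n ] (λ k → f k + g k)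
  Σ-+ zero    f g = +-identityˡ 0#
  Σ-+ (suc n) f g = trans (+-interchange _ _ _ _) (+-congˡ (Σ-+ n (f ∘ suc) (g ∘ suc)))

  Σ-comm : ∀ m n (f : Fin m → Fin n → Carrier)
    → Σ[ m ] (λ i → Σ[ n ] (f i)) ≈ Σ[ n ] (λ j → Σ[ m ] (λ i → f i j))
  Σ-comm zero    n f = sym (Σ-zero n (λ _ → refl))
  Σ-comm (suc m) n f = trans (+-congˡ (Σ-comm m n (f ∘ suc))) (Σ-+ n _ _)

  *-distribˡ-Σ : ∀ n a (f : Fin n → Carrier) → a * Σ[ n ] f ≈ Σ[ n ] (λ k → a * f k)
  *-distribˡ-Σ zero    a f = zeroʳ a
  *-distribˡ-Σ (suc n) a f = trans (distribˡ a _ _) (+-congˡ (*-distribˡ-Σ n a (f ∘ suc)))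

  *-distribʳ-Σ : ∀ n a (f : Fin n → Carrier) → Σ[ n ] f * a ≈ Σ[ n ] (λ k → f k * a)
  *-distribʳ-Σ zero    a f = zeroˡ a
  *-distribʳ-Σ (suc n) a f = trans (distribʳ a _ _) (+-congˡ (*-distribʳ-Σ n a (f ∘ suc)))

  Σ-single : ∀ {n} (f : Fin n → Carrier) j → (∀ k → k ≢ j → f k ≈ 0#) → Σ[ n ] f ≈ f j
  Σ-single f zero    others =
    trans (+-congˡ (Σ-zero _ λ k → others (suc k) λ ())) (+-identityʳ _)
  Σ-single f (suc j) others =
    trans (+-cong (others zero λ ()) (Σ-single (f ∘ suc) j λ k k≢j → others (suc k) (k≢j ∘ suc-injective)))
          (+-identityˡ _)

  Π-cong : ∀ n {f g : Fin n → Carrier} → (∀ k → f k ≈ g k) → Π[ n ] f ≈ Π[ n ] g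
  Π-cong zero    _   = refl
  Π-cong (suc n) f≈g = *-cong (f≈g zero) (Π-cong n (f≈g ∘ suc))

  Π-one : ∀ n {f : Fin n → Carrier} → (∀ k → f k ≈ 1#) → Π[ n ] f ≈ 1#
  Π-one zero    _   = refl
  Π-one (suc n) f≈1 = trans (*-cong (f≈1 zero) (Π-one n (f≈1 ∘ suc))) (*-identityˡ 1#)

  Π-removeAt : ∀ {n} (f : Fin (suc n) → Carrier) i → Π[ suc n ] f ≈ f i * Π[ n ] (removeAt f i)
  Π-removeAt         f zero    = refl
  Π-removeAt {suc n} f (suc i) = trans (*-congˡ (Π-removeAt (f ∘ suc) i)) (x∙yz≈y∙xz _ _ _)

  Π-split : ∀ {n} (f g : Fin (suc n) → Carrier) i → (∀ k → k ≢ i → f k ≈ g k)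
    → Π[ suc n ] f ≈ f i * Π[ n ] (removeAt g i)
  Π-split f g i f≈g = trans (Π-removeAt f i) (*-congˡ (Π-cong _ λ k → f≈g (punchIn i k) (punchInᵢ≢i i k)))

  *-cancelʳ-nonzero : ∀ {w x y} → w ≉ 0# → x * w ≈ y * w → x ≈ y
  *-cancelʳ-nonzero {w} {x} {y} w≉0 xw≈yw with inverse w w≉0
  ... | w⁻¹ , ww⁻¹≈1 = begin
    x              ≈⟨ *-identityʳ x ⟨
    x * 1#         ≈⟨ *-congˡ ww⁻¹≈1 ⟨
    x * (w * w⁻¹)  ≈⟨ *-assoc _ _ _ ⟨
    (x * w) * w⁻¹  ≈⟨ *-congʳ xw≈yw ⟩
    (y * w) * w⁻¹  ≈⟨ *-assoc _ _ _ ⟩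
    y * (w * w⁻¹)  ≈⟨ *-congˡ ww⁻¹≈1 ⟩
    y * 1#         ≈⟨ *-identityʳ y ⟩
    y              ∎

  *-nonzero : ∀ {x y} → x ≉ 0# → y ≉ 0# → x * y ≉ 0#
  *-nonzero x≉0 y≉0 xy≈0 = y≉0 (*-cancelʳ-nonzero x≉0 (trans (*-comm _ _) (trans xy≈0 (sym (zeroˡ _)))))

  Π-nonzero : ∀ n {f : Fin n → Carrier} → (∀ k → f k ≉ 0#) → Π[ n ] f ≉ 0#
  Π-nonzero zero    _   1≈0 = 0≉1 (sym 1≈0)
  Π-nonzero (suc n) f≉0 = *-nonzero (f≉0 zero) (Π-nonzero n (f≉0 ∘ suc))

  I-diag : ∀ {n} (i : Fin n) → I i i ≡ 1#
  I-diag i with i ≟ i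
  ... | yes _   = ≡.refl
  ... | no  i≢i = ⊥-elim (i≢i ≡.refl)

  I-off : ∀ {n} {i j : Fin n} → i ≢ j → I i j ≡ 0#
  I-off {i = i} {j} i≢j with i ≟ j
  ... | yes i≡j = ⊥-elim (i≢j i≡j)
  ... | no  _   = ≡.refl

  ·-identityˡ : ∀ {r n} (A : Mat r n) → (I · A) ≈M A
  ·-identityˡ A i j =
    trans (Σ-single _ i λ k k≢i → trans (*-congʳ (reflexive (I-off (k≢i ∘ ≡.sym)))) (zeroˡ _))
          (trans (*-congʳ (reflexive (I-diag i))) (*-identityˡ _))

  ·-identityʳ : ∀ {r n} (A : Mat r n) → (A · I) ≈M A
  ·-identityʳ A i j =
    trans (Σ-single _ j λ k k≢j → trans (*-congˡ (reflexive (I-off k≢j))) (zeroʳ _))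
          (trans (*-congˡ (reflexive (I-diag j))) (*-identityʳ _))

  ·-assoc : ∀ {a b c′ d} (A : Mat a b) (B : Mat b c′) (C : Mat c′ d) → (A · (B · C)) ≈M ((A · B) · C)
  ·-assoc {b = b} {c′} A B C i j = begin
    Σ[ b ] (λ l → A i l * Σ[ c′ ] (λ k → B l k * C k j))    ≈⟨ Σ-cong b (λ l → *-distribˡ-Σ c′ _ _) ⟩
    Σ[ b ] (λ l → Σ[ c′ ] (λ k → A i l * (B l k * C k j)))  ≈⟨ Σ-comm b c′ _ ⟩
    Σ[ c′ ] (λ k → Σ[ b ] (λ l → A i l * (B l k * C k j)))  ≈⟨ Σ-cong c′ (λ k → Σ-cong b λ l → *-assoc _ _ _) ⟨
    Σ[ c′ ] (λ k → Σ[ b ] (λ l → (A i l * B l k) * C k j))  ≈⟨ Σ-cong c′ (λ k → *-distribʳ-Σ b _ _) ⟨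
    Σ[ c′ ] (λ k → Σ[ b ] (λ l → A i l * B l k) * C k j)    ∎

  column-nonzero : ∀ {r n} {A : Mat r n} {B : Mat n r} → (B · A) ≈M I → ∀ s → ¬ ¬ Σ (Fin r) λ a → A a s ≉ 0#
  column-nonzero {r} {A = A} {B} BA≈I s ¬∃ = ¬¬-pull r (λ a A≉0 → ¬∃ (a , A≉0)) λ A≈0 → 0≉1 (begin
    0#           ≈⟨ Σ-zero r (λ a → trans (*-congˡ (A≈0 a)) (zeroʳ _)) ⟨
    (B · A) s s  ≈⟨ BA≈I s s ⟩
    I s s        ≡⟨ I-diag s ⟩
    1#           ∎)

  -- Multiplying by B turns x A = y βᵀ into x I = W βᵀ; comparing the entries of x I at two
  -- distinct columns gives x x ≈ 0.
  leftInvertible-not-rankOne-multiple : ∀ {r n} {A : Mat r n} {B : Mat n r} → (B · A) ≈M I → 1 < n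
    → ∀ {x} → x ≉ 0# → ∀ (β : Fin n → Carrier) (y : Fin r → Carrier) → ¬ (∀ a s → A a s * x ≈ β s * y a)
  leftInvertible-not-rankOne-multiple {r} {A = A} {B} BA≈I (s≤s (s≤s _)) {x} x≉0 β y Ax≈βy =
    *-nonzero x≉0 x≉0 (begin
      x * x                                              ≈⟨ *-cong (x≈βW zero) (x≈βW (suc zero)) ⟩
      (β zero * W zero) * (β (suc zero) * W (suc zero))  ≈⟨ interchange _ _ _ _ ⟩
      (β zero * β (suc zero)) * (W zero * W (suc zero))  ≈⟨ *-congʳ (*-comm _ _) ⟩
      (β (suc zero) * β zero) * (W zero * W (suc zero))  ≈⟨ interchange _ _ _ _ ⟩
      (β (suc zero) * W zero) * (β zero * W (suc zero))  ≈⟨ *-congʳ (0≈βW λ ()) ⟨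
      0# * (β zero * W (suc zero))                       ≈⟨ zeroˡ _ ⟩
      0#                                                 ∎)
    where
    W : Fin _ → Carrier
    W t = Σ[ r ] λ a → B t a * y a

    Ix≈βW : ∀ t s → I t s * x ≈ β s * W t
    Ix≈βW t s = begin
      I t s * x                          ≈⟨ *-congʳ (BA≈I t s) ⟨
      (B · A) t s * x                    ≈⟨ *-distribʳ-Σ r x _ ⟩
      Σ[ r ] (λ a → (B t a * A a s) * x)  ≈⟨ Σ-cong r (λ a → trans (*-assoc _ _ _) (*-congˡ (Ax≈βy a s))) ⟩
      Σ[ r ] (λ a → B t a * (β s * y a))  ≈⟨ Σ-cong r (λ a → x∙yz≈y∙xz _ _ _) ⟩
      Σ[ r ] (λ a → β s * (B t a * y a))  ≈⟨ *-distribˡ-Σ r (β s) _ ⟨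
      β s * W t                          ∎

    x≈βW : ∀ t → x ≈ β t * W t
    x≈βW t = trans (sym (*-identityˡ x)) (trans (*-congʳ (reflexive (≡.sym (I-diag t)))) (Ix≈βW t t))

    0≈βW : ∀ {t s} → t ≢ s → 0# ≈ β s * W t
    0≈βW {t} {s} t≢s = trans (sym (zeroˡ x)) (trans (*-congʳ (reflexive (≡.sym (I-off t≢s)))) (Ix≈βW t s))

  rightInverse-·-scalar⇒proportional : ∀ {r n} {φ φ′ : Mat r n} {ψ : Mat n r} {a}
    → (φ · ψ) ≈M I → (∀ l s → (ψ · φ′) l s ≈ a * I l s) → ∀ i s → φ′ i s ≈ a * φ i s
  rightInverse-·-scalar⇒proportional {r} {n} {φ} {φ′} {ψ} {a} φψ≈I ψφ′≈aI i s = begin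
    φ′ i s                           ≈⟨ ·-identityˡ φ′ i s ⟨
    (I · φ′) i s                     ≈⟨ Σ-cong r (λ l → *-congʳ (φψ≈I i l)) ⟨
    ((φ · ψ) · φ′) i s               ≈⟨ ·-assoc φ ψ φ′ i s ⟨
    (φ · (ψ · φ′)) i s               ≈⟨ Σ-cong n (λ l → trans (*-congˡ (ψφ′≈aI l s)) (x∙yz≈y∙xz _ _ _)) ⟩
    Σ[ n ] (λ l → a * (φ i l * I l s))  ≈⟨ *-distribˡ-Σ n a _ ⟨
    a * (φ · I) i s                  ≈⟨ *-congˡ (·-identityʳ φ i s) ⟩
    a * φ i s                        ∎

  -- decomposable m d e τ φ J is definitionally ⨂ φ (λ k → J (τ ⟨$⟩ʳ k)).
  ⨂ : ∀ {m} {r n : Fin m → ℕ} → ((k : Fin m) → Mat (r k) (n k)) → MultiIndex m r → MultiIndex m n → Carrier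
  ⨂ {m} F x u = Π[ m ] λ k → F k (x k) (u k)

  decomposable-reindex : ∀ {m} (d e : Fin m → ℕ) (τ : Permutation′ m)
      (φ : (k : Fin m) → Mat (e (τ ⟨$⟩ʳ k)) (d k)) x u
    → decomposable m d e τ φ (reindex {F = Fin ∘ e} τ x) u ≈ ⨂ φ x u
  decomposable-reindex {m} d e τ φ x u = Π-cong m λ k → reflexive (cong (λ v → φ k v (u k)) (reindex-⟨$⟩ʳ τ x k))

  ⨂-update : ∀ {n} {r c′ : Fin (suc n) → ℕ} (F : (k : Fin (suc n)) → Mat (r k) (c′ k)) x u i a s
    → ⨂ F (update x i a) (update u i s) ≈ F i a s * Π[ n ] (removeAt (λ k → F k (x k) (u k)) i)
  ⨂-update {n} F x u i a s = begin
    ⨂ F (update x i a) (update u i s)          ≈⟨ Π-split (λ k → F k (update x i a k) (update u i s k)) _ i unchanged ⟩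
    F i (update x i a i) (update u i s i) * R
      ≡⟨ cong₂ (λ a s → F i a s * R) (update-updates x i a) (update-updates u i s) ⟩
    F i a s * R                                ∎
    where
    R : Carrier
    R = Π[ n ] (removeAt (λ k → F k (x k) (u k)) i)

    unchanged : ∀ k → k ≢ i → F k (update x i a k) (update u i s k) ≈ F k (x k) (u k)
    unchanged k k≢i = reflexive (cong₂ (F k) (update-minimal x a k≢i) (update-minimal u s k≢i))

  -- Stated up to scalars a and b, which absorb the first factor when inducting on the number of factors.
  ⨂-·ˡ : ∀ {m} {r r′ c′ : Fin m → ℕ} (P : (k : Fin m) → Mat (r′ k) (r k)) {F G : (k : Fin m) → Mat (r k) (c′ k)} a b
    → (∀ x u → a * ⨂ F x u ≈ b * ⨂ G x u) → ∀ y u → a * ⨂ (λ k → P k · F k) y u ≈ b * ⨂ (λ k → P k · G k) y u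
  ⨂-·ˡ {zero}         P           a b aF≈bG y u = aF≈bG (λ ()) (λ ())
  ⨂-·ˡ {suc m} {r} P {F} {G} a b aF≈bG y u = begin
    a * ((P zero · F zero) (y zero) (u zero) * Fs)                          ≈⟨ pull a (F zero) Fs ⟩
    Σ[ r zero ] (λ l → P zero (y zero) l * ((a * F zero l (u zero)) * Fs))  ≈⟨ Σ-cong (r zero) (λ l → *-congˡ (tails l)) ⟩
    Σ[ r zero ] (λ l → P zero (y zero) l * ((b * G zero l (u zero)) * Gs))  ≈⟨ pull b (G zero) Gs ⟨
    b * ((P zero · G zero) (y zero) (u zero) * Gs)                          ∎
    where
    Fs Gs : Carrier
    Fs = ⨂ (λ k → P (suc k) · F (suc k)) (y ∘ suc) (u ∘ suc)
    Gs = ⨂ (λ k → P (suc k) · G (suc k)) (y ∘ suc) (u ∘ suc)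

    pull : ∀ c H R
      → c * ((P zero · H) (y zero) (u zero) * R) ≈ Σ[ r zero ] (λ l → P zero (y zero) l * ((c * H l (u zero)) * R))
    pull c H R = begin
      c * ((P zero · H) (y zero) (u zero) * R)                          ≈⟨ *-congˡ (*-distribʳ-Σ (r zero) R _) ⟩
      c * Σ[ r zero ] (λ l → (P zero (y zero) l * H l (u zero)) * R)    ≈⟨ *-distribˡ-Σ (r zero) c _ ⟩
      Σ[ r zero ] (λ l → c * ((P zero (y zero) l * H l (u zero)) * R))  ≈⟨ Σ-cong (r zero) (λ l → rearrange _ _ _ _) ⟩
      Σ[ r zero ] (λ l → P zero (y zero) l * ((c * H l (u zero)) * R))  ∎
      where
      rearrange : ∀ c p h R → c * ((p * h) * R) ≈ p * ((c * h) * R)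
      rearrange c p h R = trans (*-congˡ (*-assoc _ _ _)) (trans (x∙yz≈y∙xz _ _ _) (*-congˡ (sym (*-assoc _ _ _))))

    tails : ∀ l → (a * F zero l (u zero)) * Fs ≈ (b * G zero l (u zero)) * Gs
    tails l = ⨂-·ˡ (P ∘ suc) {F ∘ suc} {G ∘ suc} (a * F zero l (u zero)) (b * G zero l (u zero))
      (λ x u′ → trans (*-assoc _ _ _)
                      (trans (aF≈bG (λ { zero → l ; (suc k) → x k }) (λ { zero → u zero ; (suc k) → u′ k }))
                             (sym (*-assoc _ _ _))))
      (y ∘ suc) (u ∘ suc)

  -- Changing J at τ i and u at i changes only the i-th factor on the left, whereas on the
  -- right the new entry of J lands in the factor τ′⁻¹ (τ i) ≠ i.
  decomposable-slice : ∀ {n} {d e : Fin (suc n) → ℕ} {τ τ′ : Permutation′ (suc n)}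
      {φ : (i : Fin (suc n)) → Mat (e (τ ⟨$⟩ʳ i)) (d i)} {φ′ : (i : Fin (suc n)) → Mat (e (τ′ ⟨$⟩ʳ i)) (d i)}
    → (∀ J u → decomposable (suc n) d e τ φ J u ≈ decomposable (suc n) d e τ′ φ′ J u)
    → ∀ {i} → τ′ ⟨$⟩ʳ i ≢ τ ⟨$⟩ʳ i → ∀ J u a s
    → φ i a s * Π[ n ] (removeAt (λ k → φ k (J (τ ⟨$⟩ʳ k)) (u k)) i)
      ≈ φ′ i (J (τ′ ⟨$⟩ʳ i)) s * Π[ n ] (removeAt (λ k → φ′ k (update J (τ ⟨$⟩ʳ i) a (τ′ ⟨$⟩ʳ k)) (u k)) i)
  decomposable-slice {n} {d} {e} {τ} {τ′} {φ} {φ′} φ≈φ′ {i} τ′i≢τi J u a s = begin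
    φ i a s * X
      ≡⟨ cong₂ (λ a s → φ i a s * X) (update-updates J (τ ⟨$⟩ʳ i) a) (update-updates u i s) ⟨
    φ i (J′ (τ ⟨$⟩ʳ i)) (u′ i) * X           ≈⟨ Π-split (λ k → φ k (J′ (τ ⟨$⟩ʳ k)) (u′ k)) _ i unchanged ⟨
    decomposable (suc n) d e τ φ J′ u′        ≈⟨ φ≈φ′ J′ u′ ⟩
    decomposable (suc n) d e τ′ φ′ J′ u′      ≈⟨ Π-split (λ k → φ′ k (J′ (τ′ ⟨$⟩ʳ k)) (u′ k)) _ i unchanged′ ⟩
    φ′ i (J′ (τ′ ⟨$⟩ʳ i)) (u′ i) * Y
      ≡⟨ cong₂ (λ b s → φ′ i b s * Y) (update-minimal J a τ′i≢τi) (update-updates u i s) ⟩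
    φ′ i (J (τ′ ⟨$⟩ʳ i)) s * Y                ∎
    where
    J′ : MultiIndex (suc n) e
    J′ = update J (τ ⟨$⟩ʳ i) a

    u′ : MultiIndex (suc n) d
    u′ = update u i s

    X Y : Carrier
    X = Π[ n ] (removeAt (λ k → φ k (J (τ ⟨$⟩ʳ k)) (u k)) i)
    Y = Π[ n ] (removeAt (λ k → φ′ k (J′ (τ′ ⟨$⟩ʳ k)) (u k)) i)

    unchanged : ∀ k → k ≢ i → φ k (J′ (τ ⟨$⟩ʳ k)) (u′ k) ≈ φ k (J (τ ⟨$⟩ʳ k)) (u k)
    unchanged k k≢i = reflexive (cong₂ (φ k) (update-minimal J a (k≢i ∘ ⟨$⟩ʳ-injective τ)) (update-minimal u s k≢i))

    unchanged′ : ∀ k → k ≢ i → φ′ k (J′ (τ′ ⟨$⟩ʳ k)) (u′ k) ≈ φ′ k (J′ (τ′ ⟨$⟩ʳ k)) (u k)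
    unchanged′ k k≢i = reflexive (cong (φ′ k _) (update-minimal u s k≢i))

  -- Equality in K is not decidable, so nonzero entries of the φ_k are only found under a
  -- double negation; this suffices because the conclusion is reached by contradiction.
  decomposable-≈⇒agree-where-nontrivial : ∀ {m} {d e : Fin m → ℕ} → (∀ i → 1 ≤ d i) → ∀ {τ τ′ : Permutation′ m}
      {φ : (i : Fin m) → Mat (e (τ ⟨$⟩ʳ i)) (d i)} {φ′ : (i : Fin m) → Mat (e (τ′ ⟨$⟩ʳ i)) (d i)}
    → (∀ i → IsIso (φ i))
    → (∀ J u → decomposable m d e τ φ J u ≈ decomposable m d e τ′ φ′ J u)
    → ∀ i → 1 < d i → τ′ ⟨$⟩ʳ i ≡ τ ⟨$⟩ʳ i
  decomposable-≈⇒agree-where-nontrivial {suc n} {d} {e} dpos {τ} {τ′} {φ} {φ′} iso φ≈φ′ i 1<dᵢ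
    with τ′ ⟨$⟩ʳ i ≟ τ ⟨$⟩ʳ i
  ... | yes τ′i≡τi = τ′i≡τi
  ... | no  τ′i≢τi = ⊥-elim (¬¬-pull (suc n) nonzero-entry λ entries →
          leftInvertible-not-rankOne-multiple (proj₂ (proj₂ (iso i))) 1<dᵢ (slice-nonzero entries) _ _
            (decomposable-slice {τ = τ} {τ′} {φ} {φ′} φ≈φ′ τ′i≢τi (J entries) z))
    where
    z : MultiIndex (suc n) d
    z k = fromℕ< (dpos k)

    NonzeroEntry : Fin (suc n) → Set ℓ
    NonzeroEntry k = Σ (Fin (e (τ ⟨$⟩ʳ k))) λ r → φ k r (z k) ≉ 0#

    nonzero-entry : ∀ k → ¬ ¬ NonzeroEntry k
    nonzero-entry k = column-nonzero (proj₂ (proj₂ (iso k))) (z k)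

    J : (∀ k → NonzeroEntry k) → MultiIndex (suc n) e
    J entries = reindex τ (proj₁ ∘ entries)

    slice-nonzero : (entries : ∀ k → NonzeroEntry k)
      → Π[ n ] (removeAt (λ k → φ k (J entries (τ ⟨$⟩ʳ k)) (z k)) i) ≉ 0#
    slice-nonzero entries =
      Π-nonzero n λ k → proj₂ (entries (punchIn i k)) ∘ trans (reflexive (≡.sym (entry (punchIn i k))))
      where
      entry : ∀ k → φ k (J entries (τ ⟨$⟩ʳ k)) (z k) ≡ φ k (proj₁ (entries k)) (z k)
      entry k = cong (λ v → φ k v (z k)) (reindex-⟨$⟩ʳ τ (proj₁ ∘ entries) k)

  decomposable-≈⇒factorisation : ∀ {m} {d e : Fin m → ℕ} → (∀ i → 1 ≤ d i) → ∀ {τ τ′ : Permutation′ m}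
      {φ : (i : Fin m) → Mat (e (τ ⟨$⟩ʳ i)) (d i)} {φ′ : (i : Fin m) → Mat (e (τ′ ⟨$⟩ʳ i)) (d i)}
    → (∀ i → IsIso (φ i))
    → (∀ J u → decomposable m d e τ φ J u ≈ decomposable m d e τ′ φ′ J u)
    → Σ (Permutation′ m) (λ σ → (∀ i → τ′ ⟨$⟩ʳ i ≡ τ ⟨$⟩ʳ (σ ⟨$⟩ʳ i)) × (∀ i → 1 < d i → σ ⟨$⟩ʳ i ≡ i))
      × ((∀ i j → d i ≡ 1 → d j ≡ 1 → i ≡ j) → ∀ i → τ′ ⟨$⟩ʳ i ≡ τ ⟨$⟩ʳ i)
  decomposable-≈⇒factorisation {d = d} dpos {τ} {τ′} {φ} {φ′} iso φ≈φ′
    with agreement⇒factorisation τ τ′ (λ i → 1 < d i)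
           (decomposable-≈⇒agree-where-nontrivial dpos {τ} {τ′} {φ} {φ′} iso φ≈φ′)
  ... | σ , τ′≡τσ , σ-fixes = (σ , τ′≡τσ , σ-fixes) , λ unique i →
          ≡.trans (τ′≡τσ i) (cong (τ ⟨$⟩ʳ_) (fixes-all-but-one⇒fixes-all σ (λ i → d i ≡ 1) unique fixes i))
    where
    fixes : ∀ i → d i ≢ 1 → σ ⟨$⟩ʳ i ≡ i
    fixes i dᵢ≢1 = σ-fixes i (≤∧≢⇒< (dpos i) (dᵢ≢1 ∘ ≡.sym))

  ⨂-identity⇒scalar-factors : ∀ {m} {d : Fin m → ℕ} (A : (k : Fin m) → Mat (d k) (d k)) (z : MultiIndex m d)
    → (∀ y u → ⨂ (λ k → I) y u ≈ ⨂ A y u)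
    → ∀ i → A i (z i) (z i) ≉ 0# × (∀ r s → A i r s ≈ A i (z i) (z i) * I r s)
  ⨂-identity⇒scalar-factors {suc n} A z I≈A i = λᵢ≉0 , Aᵢ≈λᵢI
    where
    λᵢ : Carrier
    λᵢ = A i (z i) (z i)

    R : Carrier
    R = Π[ n ] (removeAt (λ k → A k (z k) (z k)) i)

    I≈AR : ∀ r s → I r s ≈ A i r s * R
    I≈AR r s = begin
      I r s                                               ≈⟨ *-identityʳ _ ⟨
      I r s * 1#                                          ≈⟨ *-congˡ (Π-one n λ k → reflexive (I-diag (z (punchIn i k)))) ⟨
      I r s * Π[ n ] (removeAt (λ k → I (z k) (z k)) i)   ≈⟨ ⨂-update (λ k → I) z z i r s ⟨
      ⨂ (λ k → I) (update z i r) (update z i s)           ≈⟨ I≈A (update z i r) (update z i s) ⟩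
      ⨂ A (update z i r) (update z i s)                   ≈⟨ ⨂-update A z z i r s ⟩
      A i r s * R                                         ∎

    1≈λᵢR : 1# ≈ λᵢ * R
    1≈λᵢR = trans (reflexive (≡.sym (I-diag (z i)))) (I≈AR (z i) (z i))

    λᵢ≉0 : λᵢ ≉ 0#
    λᵢ≉0 λᵢ≈0 = 0≉1 (sym (trans 1≈λᵢR (trans (*-congʳ λᵢ≈0) (zeroˡ R))))

    R≉0 : R ≉ 0#
    R≉0 R≈0 = 0≉1 (sym (trans 1≈λᵢR (trans (*-congˡ R≈0) (zeroʳ λᵢ))))

    Aᵢ≈λᵢI : ∀ r s → A i r s ≈ λᵢ * I r s
    Aᵢ≈λᵢI r s = *-cancelʳ-nonzero R≉0 (begin
      A i r s * R       ≈⟨ I≈AR r s ⟨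
      I r s             ≈⟨ *-identityˡ _ ⟨
      1# * I r s        ≈⟨ *-congʳ 1≈λᵢR ⟩
      (λᵢ * R) * I r s  ≈⟨ xy∙z≈xz∙y _ _ _ ⟩
      (λᵢ * I r s) * R  ∎)

  decomposable-≈⇒proportional : ∀ {m} {d e : Fin m → ℕ} → (∀ i → 1 ≤ d i) → ∀ {τ : Permutation′ m}
      {φ φ′ : (i : Fin m) → Mat (e (τ ⟨$⟩ʳ i)) (d i)} → (∀ i → IsIso (φ i))
    → (∀ J u → decomposable m d e τ φ J u ≈ decomposable m d e τ φ′ J u)
    → Σ (Fin m → Carrier) λ λs → (∀ i → ¬ (λs i ≈ 0#)) × (∀ i r s → φ′ i r s ≈ λs i * φ i r s) × (Π[ m ] λs ≈ 1#)
  decomposable-≈⇒proportional {m} {d} {e} dpos {τ} {φ} {φ′} iso φ≈φ′ =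
    λs , proj₁ ∘ scalar , φ′≈λsφ , Πλs≈1
    where
    ψ : (i : Fin m) → Mat (d i) (e (τ ⟨$⟩ʳ i))
    ψ i = proj₁ (iso i)

    A : (i : Fin m) → Mat (d i) (d i)
    A i = ψ i · φ′ i

    z : MultiIndex m d
    z k = fromℕ< (dpos k)

    I≈A : ∀ y u → ⨂ (λ k → I) y u ≈ ⨂ A y u
    I≈A y u = begin
      ⨂ (λ k → I) y u              ≈⟨ Π-cong m (λ k → proj₂ (proj₂ (iso k)) (y k) (u k)) ⟨
      ⨂ (λ k → ψ k · φ k) y u      ≈⟨ *-identityˡ _ ⟨
      1# * ⨂ (λ k → ψ k · φ k) y u  ≈⟨ ⨂-·ˡ ψ {φ} {φ′} 1# 1# (λ x u → *-congˡ (⨂φ≈⨂φ′ x u)) y u ⟩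
      1# * ⨂ A y u                 ≈⟨ *-identityˡ _ ⟩
      ⨂ A y u                      ∎
      where
      ⨂φ≈⨂φ′ : ∀ x u → ⨂ φ x u ≈ ⨂ φ′ x u
      ⨂φ≈⨂φ′ x u = begin
        ⨂ φ x u                                 ≈⟨ decomposable-reindex d e τ φ x u ⟨
        decomposable m d e τ φ (reindex τ x) u   ≈⟨ φ≈φ′ (reindex τ x) u ⟩
        decomposable m d e τ φ′ (reindex τ x) u  ≈⟨ decomposable-reindex d e τ φ′ x u ⟩
        ⨂ φ′ x u                                ∎

    λs : Fin m → Carrier
    λs i = A i (z i) (z i)

    scalar : ∀ i → λs i ≉ 0# × (∀ r s → A i r s ≈ λs i * I r s)
    scalar = ⨂-identity⇒scalar-factors A z I≈A

    φ′≈λsφ : ∀ i r s → φ′ i r s ≈ λs i * φ i r s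
    φ′≈λsφ i = rightInverse-·-scalar⇒proportional (proj₁ (proj₂ (iso i))) (proj₂ (scalar i))

    Πλs≈1 : Π[ m ] λs ≈ 1#
    Πλs≈1 = trans (sym (I≈A z z)) (Π-one m λ k → reflexive (I-diag (z k)))

proposition3p3 : ∀ {c ℓ} (K : Field c ℓ) → let open FieldOps K in
    ((m : ℕ) (d e : Fin m → ℕ)
      → (∀ i → 1 ≤ d i) → (∀ j → 1 ≤ e j)
      → (τ τ′ : Permutation′ m)
      → (∀ i → e (τ ⟨$⟩ʳ i) ≡ d i) → (∀ i → e (τ′ ⟨$⟩ʳ i) ≡ d i)
      → (φ : (i : Fin m) → Mat (e (τ ⟨$⟩ʳ i)) (d i)) → (∀ i → IsIso (φ i))
      → (φ′ : (i : Fin m) → Mat (e (τ′ ⟨$⟩ʳ i)) (d i)) → (∀ i → IsIso (φ′ i))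
      → (∀ J I′ → decomposable m d e τ φ J I′ ≈ decomposable m d e τ′ φ′ J I′)
      → Σ (Permutation′ m) (λ σ →
            (∀ i → τ′ ⟨$⟩ʳ i ≡ τ ⟨$⟩ʳ (σ ⟨$⟩ʳ i))
          × (∀ i → 1 < d i → σ ⟨$⟩ʳ i ≡ i))
        × ((∀ i j → d i ≡ 1 → d j ≡ 1 → i ≡ j) → ∀ i → τ′ ⟨$⟩ʳ i ≡ τ ⟨$⟩ʳ i))
    ×
    ((m : ℕ) (d e : Fin m → ℕ)
      → (∀ i → 1 ≤ d i) → (∀ j → 1 ≤ e j)
      → (τ : Permutation′ m)
      → (∀ i → e (τ ⟨$⟩ʳ i) ≡ d i)
      → (φ : (i : Fin m) → Mat (e (τ ⟨$⟩ʳ i)) (d i)) → (∀ i → IsIso (φ i))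
      → (φ′ : (i : Fin m) → Mat (e (τ ⟨$⟩ʳ i)) (d i)) → (∀ i → IsIso (φ′ i))
      → (∀ J I′ → decomposable m d e τ φ J I′ ≈ decomposable m d e τ φ′ J I′)
      → Σ (Fin m → Carrier) (λ λs →
            (∀ i → ¬ (λs i ≈ 0#))
          × (∀ i r s → φ′ i r s ≈ λs i * φ i r s)
          × (Π[ m ] λs ≈ 1#)))
proposition3p3 K =
    (λ m d e dpos _ τ τ′ _ _ φ iso φ′ _ → decomposable-≈⇒factorisation K {m} {d} {e} dpos {τ} {τ′} {φ} {φ′} iso)
  , (λ m d e dpos _ τ _ φ iso φ′ _ → decomposable-≈⇒proportional K {m} {d} {e} dpos {τ} {φ} {φ′} iso)
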